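{- Every regular diagram is proper.
   Context: A diagram of length $n$ is a simple graph on sites $\{1,\dots,n\}$ whose edges (arcs) are pairs $(s_1,s_2)$ with $s_1<s_2$ and $1<s_2-s_1<n-1$, supported by $s_1,s_2$. A diagram is binary if it has at least one arc and each site supports at most one arc. A site is free if it supports no arc; $s$ is covered by $(s_1,s_2)$ if $s_1<s<s_2$. Arcs $(s_1,s_2),(s_1',s_2')$ cross if $s_1<s_1'<s_2<s_2'$ or $s_1'<s_1<s_2'<s_2$. A diagram is proper if it is binary, each arc covers at least one free site, and no arc covers all free sites. If $u_1<\dots<u_f$ are the free sites, $u_0=0$, $u_{f+1}=n+1$, the $i$-th block is the set of sites $s$ with $u_{i-1}<s<u_i$. A diagram is regular if it is binary and there are no two crossing arcs $e_1,e_2$ with a supporting site of $e_1$ and a supporting site of $e_2$ in a common block. -}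

module Defs where

open import Data.Nat using (ℕ; zero; suc; _+_; _∸_; _≤_; _<_)
open import Data.Bool using (Bool; true; false; not; _∨_)
open import Data.List using (List; []; _∷_; _++_; map; upTo; filterᵇ)
open import Data.Bool.ListAction using (any)
open import Data.List.Membership.Propositional using (_∈_)
open import Data.List.Relation.Unary.Any using (Any)
open import Data.Product using (Σ; ∃; ∃-syntax; _×_; _,_)
open import Data.Sum using (_⊎_)
open import Relation.Nullary using (¬_)
open import Relation.Binary.PropositionalEquality using (_≡_)

-- A diagram of length n: a simple graph on the sites {1,…,n}, given by a
-- (decidable) arc relation `arc s₁ s₂` on ordered pairs s₁ < s₂.
record Diagram (n : ℕ) : Set where
  field
    arc   : ℕ → ℕ → Bool
    valid : ∀ s₁ s₂ → arc s₁ s₂ ≡ true →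
            1 ≤ s₁ × s₁ < s₂ × s₂ ≤ n × 1 < s₂ ∸ s₁ × s₂ ∸ s₁ < n ∸ 1
open Diagram public

module _ {n : ℕ} (D : Diagram n) where

  Arc : ℕ → ℕ → Set
  Arc s₁ s₂ = arc D s₁ s₂ ≡ true

  SupportsArc : ℕ → ℕ → ℕ → Set
  SupportsArc s s₁ s₂ = s ≡ s₁ ⊎ s ≡ s₂

  sites : List ℕ
  sites = map suc (upTo n)

  -- does site s support some arc? (all arcs have endpoints in 1..n)
  supportsᵇ : ℕ → Bool
  supportsᵇ s = any (λ t → arc D s t ∨ arc D t s) (upTo (suc n))

  freeSites : List ℕ
  freeSites = filterᵇ (λ s → not (supportsᵇ s)) sites

  Free : ℕ → Set
  Free s = s ∈ freeSites

  Covers : ℕ → ℕ → ℕ → Set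
  Covers s₁ s₂ s = s₁ < s × s < s₂

  Binary : Set
  Binary = (∃[ a ] ∃[ b ] Arc a b)
         × (∀ s a b c d → Arc a b → Arc c d →
              SupportsArc s a b → SupportsArc s c d → a ≡ c × b ≡ d)

  Proper : Set
  Proper = Binary
         × (∀ a b → Arc a b → ∃[ s ] (Free s × Covers a b s))
         × (∀ a b → Arc a b → ∃[ s ] (Free s × ¬ Covers a b s))

  Cross : ℕ → ℕ → ℕ → ℕ → Set
  Cross a b c d = (a < c × c < b × b < d) ⊎ (c < a × a < d × d < b)

  gaps : List ℕ → List (ℕ × ℕ)
  gaps (x ∷ y ∷ l) = (x , y) ∷ gaps (y ∷ l)
  gaps _ = []

  -- u₀ = 0, u₁ < … < u_f the free sites, u_{f+1} = n+1
  boundaries : List ℕ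
  boundaries = 0 ∷ freeSites ++ (suc n ∷ [])

  -- the i-th block is {s | u_{i-1} < s < u_i}; s and t lie in a common block
  SameBlock : ℕ → ℕ → Set
  SameBlock s t = Any (λ { (l , r) → (l < s × s < r) × (l < t × t < r) }) (gaps boundaries)

  Regular : Set
  Regular = Binary
          × (∀ a b c d → Arc a b → Arc c d → Cross a b c d →
               ∀ x y → SupportsArc x a b → SupportsArc y c d → ¬ SameBlock x y)

-- In a regular diagram, two arcs supported at adjacent sites cannot cross, since adjacent
-- non-free sites lie in one block; being distinct arcs of a binary diagram they share no
-- endpoint, so one is nested in the other or they are disjoint. If an arc (a,b) covered no
-- free site, the arc at the non-free site a+1 would be nested strictly inside (a,b) and
-- again cover no free site, so right endpoints would decrease forever. If (a,b) covered
-- every free site, the arc at the neighbouring site a-1 (or b+1 when a = 1) either is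
-- disjoint from (a,b), and so covers no free site, or encloses (a,b) and again covers
-- every free site, so left endpoints would decrease forever.
module Submission where

open import Defs
open import Data.Nat using (ℕ; zero; suc; _≤_; _<_; z≤n; s≤s; _<?_)
open import Data.Nat.Properties
open import Data.Nat.Induction using (<-wellFounded)
open import Data.Bool using (Bool; T; T?; not; true; false; _∨_)
open import Data.Bool.Properties using (T-≡; T-∨; T-not-≡)
open import Data.List using ([]; _∷_; _++_; upTo)
open import Data.List.Membership.Propositional using (_∈_; find; lose)
open import Data.List.Membership.Propositional.Properties
  using (∈-map⁺; ∈-++⁻; ∈-++⁺ʳ; ∈-filter⁺; ∈-filter⁻; ∈-upTo⁺)
open import Data.List.Relation.Unary.Any as Any using (Any; here; there; any?)
open import Data.List.Relation.Unary.Any.Properties using (any⁺; any⁻)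
open import Data.Product using (∃-syntax; _×_; _,_; proj₁; proj₂; swap)
open import Data.Sum using (_⊎_; inj₁; inj₂)
open import Data.Empty using (⊥; ⊥-elim)
open import Data.Unit using (tt)
open import Function using (_∘_; Equivalence)
open import Induction.WellFounded using (Acc; acc)
open import Relation.Nullary using (¬_; yes; no; contradiction)
open import Relation.Nullary.Decidable using (_×-dec_; ¬?; decidable-stable)
open import Level using (0ℓ)
open import Relation.Unary using (Pred; Decidable)
open import Relation.Binary using (tri<; tri≈; tri>)
open import Relation.Binary.PropositionalEquality using (_≡_; refl; subst)

T-not⁺ : ∀ {b} → ¬ T b → T (not b)
T-not⁺ {false} _ = tt
T-not⁺ {true}  ¬t = ¬t tt

Adjacent : ℕ → ℕ → Set
Adjacent x y = suc x ≡ y ⊎ suc y ≡ x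

Outside : ℕ → ℕ → ℕ → Set
Outside a b s = s < a ⊎ b < s

data Placement (a b c d : ℕ) : Set where
  inside : a < c → d < b → Placement a b c d
  around : c < a → b < d → Placement a b c d
  apart  : d < a ⊎ b < c → Placement a b c d

module _ {n : ℕ} (D : Diagram n) where

  ArcAt : ℕ → Set
  ArcAt s = ∃[ c ] ∃[ d ] (Arc D c d × SupportsArc D s c d)

  CoversNoFree : ℕ → ℕ → Set
  CoversNoFree a b = ∀ s → Free D s → ¬ Covers D a b s

  CoversAllFree : ℕ → ℕ → Set
  CoversAllFree a b = ∀ s → Free D s → Covers D a b s

  Site : ℕ → Set
  Site s = 1 ≤ s × s ≤ n

  NoCommonSite : ℕ → ℕ → ℕ → ℕ → Set
  NoCommonSite a b c d = ∀ s → SupportsArc D s a b → ¬ SupportsArc D s c d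

  arc-bounds : ∀ {a b s} → Arc D a b → SupportsArc D s a b → Site s
  arc-bounds {a} {b} ab s∈ab with valid D a b ab
  arc-bounds ab (inj₁ refl) | 1≤a , a<b , b≤n , _ = 1≤a , ≤-trans (<⇒≤ a<b) b≤n
  arc-bounds ab (inj₂ refl) | 1≤a , a<b , b≤n , _ = ≤-trans 1≤a (<⇒≤ a<b) , b≤n

  arc-ordered : ∀ {a b} → Arc D a b → a < b
  arc-ordered {a} {b} ab = proj₁ (proj₂ (valid D a b ab))

  arc-span : ∀ {a b} → Arc D a b → suc a < b
  arc-span {a} {b} ab with valid D a b ab
  ... | _ , a<b , _ , 1<b∸a , _ = m≤o∸n⇒m+n≤o 2 (<⇒≤ a<b) 1<b∸a

  private
    unsupportedᵇ : ℕ → Bool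
    unsupportedᵇ s = not (supportsᵇ D s)

  supports⇒¬Free : ∀ {s} → T (supportsᵇ D s) → ¬ Free D s
  supports⇒¬Free sup free =
    subst T (Equivalence.to T-not-≡ (proj₂ (∈-filter⁻ (T? ∘ unsupportedᵇ) {xs = sites D} free))) sup

  ¬supports⇒Free : ∀ {s} → Site s → ¬ T (supportsᵇ D s) → Free D s
  ¬supports⇒Free {suc s} (_ , s<n) ¬sup =
    ∈-filter⁺ (T? ∘ unsupportedᵇ) (∈-map⁺ suc (∈-upTo⁺ s<n)) (T-not⁺ ¬sup)

  arc⇒¬Free : ∀ {a b s} → Arc D a b → SupportsArc D s a b → ¬ Free D s
  arc⇒¬Free ab (inj₁ refl) = supports⇒¬Free (any⁺ _ (lose (∈-upTo⁺ (s≤s (proj₂ (arc-bounds ab (inj₂ refl)))))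
    (Equivalence.from T-∨ (inj₁ (Equivalence.from T-≡ ab)))))
  arc⇒¬Free ab (inj₂ refl) = supports⇒¬Free (any⁺ _ (lose (∈-upTo⁺ (s≤s (proj₂ (arc-bounds ab (inj₁ refl)))))
    (Equivalence.from T-∨ (inj₂ (Equivalence.from T-≡ ab)))))

  ¬Free⇒arcAt : ∀ {s} → Site s → ¬ Free D s → ArcAt s
  ¬Free⇒arcAt {s} s-site ¬free with T? (supportsᵇ D s)
  ... | no ¬sup = contradiction (¬supports⇒Free s-site ¬sup) ¬free
  ... | yes sup with find (any⁻ (λ t → arc D s t ∨ arc D t s) (upTo (suc n)) sup)
  ...   | t , _ , arc∨arc with Equivalence.to T-∨ arc∨arc
  ...     | inj₁ st = s , t , Equivalence.to T-≡ st , inj₁ refl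
  ...     | inj₂ ts = t , s , Equivalence.to T-≡ ts , inj₂ refl

  Straddles : ℕ → ℕ → ℕ × ℕ → Set
  Straddles x y (l , r) = (l < x × x < r) × (l < y × y < r)

  gaps-straddle : ∀ {x y} l L → x ≤ y → l < x → (∀ z → z ∈ L → Outside x y z) →
                  Any (y <_) L → Any (Straddles x y) (gaps D (l ∷ L))
  gaps-straddle l [] _ _ _ ()
  gaps-straddle {x} {y} l (z ∷ L) x≤y l<x outside y<L with outside z (here refl)
  ... | inj₂ y<z = here ((l<x , ≤-<-trans x≤y y<z) , (<-≤-trans l<x x≤y , y<z))
  ... | inj₁ z<x = there (gaps-straddle z L x≤y z<x (λ w → outside w ∘ there) (tail y<L))
    where
    tail : Any (y <_) (z ∷ L) → Any (y <_) L
    tail (here y<z)  = contradiction (<-trans z<x (≤-<-trans x≤y y<z)) (<-irrefl refl)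
    tail (there y<L) = y<L

  freeOutside⇒SameBlock : ∀ {x y} → 1 ≤ x → x ≤ y → y ≤ n →
                          (∀ z → Free D z → Outside x y z) → SameBlock D x y
  freeOutside⇒SameBlock {x} {y} 1≤x x≤y y≤n outside =
    Any.map (λ { {_ , _} straddle → straddle })
      (gaps-straddle 0 (freeSites D ++ suc n ∷ []) x≤y 1≤x boundary-outside
        (lose (∈-++⁺ʳ (freeSites D) (here refl)) (s≤s y≤n)))
    where
    boundary-outside : ∀ z → z ∈ freeSites D ++ suc n ∷ [] → Outside x y z
    boundary-outside z z∈ with ∈-++⁻ (freeSites D) z∈
    ... | inj₁ free         = outside z free
    ... | inj₂ (here refl) = inj₂ (s≤s y≤n)

  SameBlock-sym : ∀ {x y} → SameBlock D x y → SameBlock D y x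
  SameBlock-sym = Any.map (λ { {_ , _} → swap })

  nonFree-adjacent⇒SameBlock : ∀ {x} → 1 ≤ x → suc x ≤ n → ¬ Free D x → ¬ Free D (suc x) →
                               SameBlock D x (suc x)
  nonFree-adjacent⇒SameBlock {x} 1≤x sx≤n ¬free-x ¬free-sx =
    freeOutside⇒SameBlock 1≤x (n≤1+n x) sx≤n outside
    where
    outside : ∀ z → Free D z → Outside x (suc x) z
    outside z free with <-cmp z x
    ... | tri< z<x _ _  = inj₁ z<x
    ... | tri≈ _ refl _ = contradiction free ¬free-x
    ... | tri> _ _ x<z with m≤n⇒m<n∨m≡n x<z
    ...   | inj₁ sx<z  = inj₂ sx<z
    ...   | inj₂ refl  = contradiction free ¬free-sx

  arcs-adjacent⇒SameBlock : ∀ {a b c d x y} → Arc D a b → Arc D c d →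
                            SupportsArc D x a b → SupportsArc D y c d → Adjacent x y → SameBlock D x y
  arcs-adjacent⇒SameBlock ab cd x∈ab y∈cd (inj₁ refl) =
    nonFree-adjacent⇒SameBlock (proj₁ (arc-bounds ab x∈ab)) (proj₂ (arc-bounds cd y∈cd))
      (arc⇒¬Free ab x∈ab) (arc⇒¬Free cd y∈cd)
  arcs-adjacent⇒SameBlock ab cd x∈ab y∈cd (inj₂ refl) = SameBlock-sym
    (nonFree-adjacent⇒SameBlock (proj₁ (arc-bounds cd y∈cd)) (proj₂ (arc-bounds ab x∈ab))
      (arc⇒¬Free cd y∈cd) (arc⇒¬Free ab x∈ab))

  covered⇒Site : ∀ {a b s} → Arc D a b → Covers D a b s → Site s
  covered⇒Site ab (a<s , s<b) =
    ≤-trans (proj₁ (arc-bounds ab (inj₁ refl))) (<⇒≤ a<s) ,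
    ≤-trans (<⇒≤ s<b) (proj₂ (arc-bounds ab (inj₂ refl)))

  covered⇒unsupported : ∀ {a b s} → Covers D a b s → ¬ SupportsArc D s a b
  covered⇒unsupported (a<s , _)   (inj₁ refl) = <-irrefl refl a<s
  covered⇒unsupported (_   , s<b) (inj₂ refl) = <-irrefl refl s<b

  outside⇒unsupported : ∀ {a b s} → Arc D a b → Outside a b s → ¬ SupportsArc D s a b
  outside⇒unsupported _  (inj₁ s<a) (inj₁ refl) = <-irrefl refl s<a
  outside⇒unsupported _  (inj₂ b<s) (inj₂ refl) = <-irrefl refl b<s
  outside⇒unsupported ab (inj₁ b<a) (inj₂ refl) = <-asym b<a (arc-ordered ab)
  outside⇒unsupported ab (inj₂ b<a) (inj₁ refl) = <-asym b<a (arc-ordered ab)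

  covered⇒¬Outside : ∀ {a b s} → Covers D a b s → ¬ Outside a b s
  covered⇒¬Outside (a<s , _)   (inj₁ s<a) = <-asym a<s s<a
  covered⇒¬Outside (_   , s<b) (inj₂ b<s) = <-asym s<b b<s

  endpoint-between : ∀ {c d s} → c < d → SupportsArc D s c d → c ≤ s × s ≤ d
  endpoint-between c<d (inj₁ refl) = ≤-refl , <⇒≤ c<d
  endpoint-between c<d (inj₂ refl) = <⇒≤ c<d , ≤-refl

  inside-endpoint-covered : ∀ {a b c d s} → a < c → d < b → c < d → SupportsArc D s c d → Covers D a b s
  inside-endpoint-covered a<c d<b c<d s∈cd with endpoint-between c<d s∈cd
  ... | c≤s , s≤d = <-≤-trans a<c c≤s , ≤-<-trans s≤d d<b

  around-endpoint-outside : ∀ {a b c d s} → c < a → b < d → SupportsArc D s c d → Outside a b s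
  around-endpoint-outside c<a _   (inj₁ refl) = inj₁ c<a
  around-endpoint-outside _   b<d (inj₂ refl) = inj₂ b<d

  apart⇒¬Covers : ∀ {a b c d s} → d < a ⊎ b < c → c ≤ s × s ≤ d → ¬ Covers D a b s
  apart⇒¬Covers (inj₁ d<a) (_ , s≤d) (a<s , _) = <-asym a<s (≤-<-trans s≤d d<a)
  apart⇒¬Covers (inj₂ b<c) (c≤s , _) (_ , s<b) = <-asym s<b (<-≤-trans b<c c≤s)

  placement : ∀ {a b c d} → NoCommonSite a b c d → ¬ Cross D a b c d → Placement a b c d
  placement {a} {b} {c} {d} distinct ¬cross with <-cmp a c
  ... | tri≈ _ a≡c _ = ⊥-elim (distinct a (inj₁ refl) (inj₁ a≡c))
  ... | tri< a<c _ _ with <-cmp b c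
  ...   | tri< b<c _ _ = apart (inj₂ b<c)
  ...   | tri≈ _ b≡c _ = ⊥-elim (distinct b (inj₂ refl) (inj₁ b≡c))
  ...   | tri> _ _ c<b with <-cmp b d
  ...     | tri< b<d _ _ = ⊥-elim (¬cross (inj₁ (a<c , c<b , b<d)))
  ...     | tri≈ _ b≡d _ = ⊥-elim (distinct b (inj₂ refl) (inj₂ b≡d))
  ...     | tri> _ _ d<b = inside a<c d<b
  placement {a} {b} {c} {d} distinct ¬cross | tri> _ _ c<a with <-cmp a d
  ...   | tri> _ _ d<a = apart (inj₁ d<a)
  ...   | tri≈ _ a≡d _ = ⊥-elim (distinct a (inj₁ refl) (inj₂ a≡d))
  ...   | tri< a<d _ _ with <-cmp b d
  ...     | tri< b<d _ _ = around c<a b<d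
  ...     | tri≈ _ b≡d _ = ⊥-elim (distinct b (inj₂ refl) (inj₂ b≡d))
  ...     | tri> _ _ d<b = ⊥-elim (¬cross (inj₂ (c<a , a<d , d<b)))

  outer-neighbour : ∀ {a b} → Arc D a b →
                    ∃[ x ] ∃[ y ] (SupportsArc D y a b × Adjacent y x × Outside a b x × Site x)
  outer-neighbour {suc (suc k)} {b} ab =
    suc k , suc (suc k) , inj₁ refl , inj₂ refl , inj₁ (n<1+n (suc k)) ,
    s≤s z≤n , ≤-trans (n≤1+n (suc k)) (proj₂ (arc-bounds ab (inj₁ refl)))
  -- for a = 1 the bound b - 1 < n - 1 on the length of the arc leaves room for b + 1
  outer-neighbour {suc zero} {b} ab with valid D 1 b ab
  ... | _ , _ , _ , _ , b∸1<n∸1 =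
    suc b , b , inj₂ refl , inj₁ refl , inj₂ (n<1+n b) ,
    s≤s z≤n , ≰⇒> (λ n≤b → <⇒≱ b∸1<n∸1 (∸-monoˡ-≤ 1 n≤b))
  outer-neighbour {zero} {b} ab with valid D 0 b ab
  ... | () , _

  free-search : ∀ {P : Pred ℕ 0ℓ} → Decidable P → ¬ (∀ s → Free D s → ¬ P s) → ∃[ s ] (Free D s × P s)
  free-search P? ¬none with any? P? (freeSites D)
  ... | yes some = find some
  ... | no ¬some = contradiction (λ s free Ps → ¬some (lose free Ps)) ¬none

module _ {n : ℕ} (D : Diagram n) (regular : Regular D) where

  adjacent⇒¬Cross : ∀ {a b c d x y} → Arc D a b → Arc D c d →
                    SupportsArc D x a b → SupportsArc D y c d → Adjacent x y → ¬ Cross D a b c d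
  adjacent⇒¬Cross ab cd x∈ab y∈cd adj cross =
    proj₂ regular _ _ _ _ ab cd cross _ _ x∈ab y∈cd (arcs-adjacent⇒SameBlock D ab cd x∈ab y∈cd adj)

  unshared⇒NoCommonSite : ∀ {a b c d x} → Arc D a b → Arc D c d →
                          SupportsArc D x c d → ¬ SupportsArc D x a b → NoCommonSite D a b c d
  unshared⇒NoCommonSite ab cd x∈cd x∉ab s s∈ab s∈cd
    with proj₂ (proj₁ regular) s _ _ _ _ ab cd s∈ab s∈cd
  ... | refl , refl = x∉ab x∈cd

  PlacedArcAt : ℕ → ℕ → ℕ → Set
  PlacedArcAt a b x = ∃[ c ] ∃[ d ] (Arc D c d × SupportsArc D x c d × Placement a b c d)

  neighbour-placedArc : ∀ {a b x y} → Arc D a b → SupportsArc D y a b → Adjacent y x →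
                        ¬ SupportsArc D x a b → Site D x → ¬ Free D x → PlacedArcAt a b x
  neighbour-placedArc ab y∈ab adj x∉ab x-site ¬free
    with ¬Free⇒arcAt D x-site ¬free
  ... | c , d , cd , x∈cd =
    c , d , cd , x∈cd ,
    placement D (unshared⇒NoCommonSite ab cd x∈cd x∉ab) (adjacent⇒¬Cross ab cd y∈ab x∈cd adj)

  arc⇒¬CoversNoFree : ∀ {a b} → Arc D a b → ¬ CoversNoFree D a b
  arc⇒¬CoversNoFree ab = go (<-wellFounded _) ab
    where
    go : ∀ {a b} → Acc _<_ b → Arc D a b → ¬ CoversNoFree D a b
    go {a} {b} (acc smaller) ab noFree = refute
      (neighbour-placedArc ab (inj₁ refl) (inj₁ refl) (covered⇒unsupported D sa-covered)
        (covered⇒Site D ab sa-covered) (λ free → noFree (suc a) free sa-covered))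
      where
      sa-covered : Covers D a b (suc a)
      sa-covered = n<1+n a , arc-span D ab

      refute : PlacedArcAt a b (suc a) → ⊥
      refute (_ , _ , cd , _ , inside a<c d<b) =
        go (smaller d<b) cd (λ s free (c<s , s<d) → noFree s free (<-trans a<c c<s , <-trans s<d d<b))
      refute (_ , _ , _ , sa∈cd , around c<a b<d) =
        covered⇒¬Outside D sa-covered (around-endpoint-outside D c<a b<d sa∈cd)
      refute (_ , _ , cd , sa∈cd , apart separated) =
        apart⇒¬Covers D separated (endpoint-between D (arc-ordered D cd) sa∈cd) sa-covered

  arc⇒¬CoversAllFree : ∀ {a b} → Arc D a b → ¬ CoversAllFree D a b
  arc⇒¬CoversAllFree ab = go (<-wellFounded _) ab
    where
    go : ∀ {a b} → Acc _<_ a → Arc D a b → ¬ CoversAllFree D a b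
    go {a} {b} (acc smaller) ab allFree with outer-neighbour D ab
    ... | x , _ , y∈ab , adj , x-outside , x-site = refute
      (neighbour-placedArc ab y∈ab adj (outside⇒unsupported D ab x-outside) x-site
        (λ free → covered⇒¬Outside D (allFree x free) x-outside))
      where
      refute : PlacedArcAt a b x → ⊥
      refute (_ , _ , cd , x∈cd , inside a<c d<b) =
        covered⇒¬Outside D (inside-endpoint-covered D a<c d<b (arc-ordered D cd) x∈cd) x-outside
      refute (_ , _ , cd , _ , around c<a b<d) =
        go (smaller c<a) cd (λ s free → let (a<s , s<b) = allFree s free in <-trans c<a a<s , <-trans s<b b<d)
      refute (_ , _ , cd , _ , apart separated) =
        arc⇒¬CoversNoFree cd (λ s free (c<s , s<d) →
          apart⇒¬Covers D separated (<⇒≤ c<s , <⇒≤ s<d) (allFree s free))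

lemma4p1 : ∀ {n : ℕ} (D : Diagram n) → Regular D → Proper D
lemma4p1 D regular = proj₁ regular , coversSomeFree , avoidsSomeFree
  where
  Covers? : ∀ a b → Decidable (Covers D a b)
  Covers? a b s = (a <? s) ×-dec (s <? b)

  coversSomeFree : ∀ a b → Arc D a b → ∃[ s ] (Free D s × Covers D a b s)
  coversSomeFree a b ab = free-search D (Covers? a b) (arc⇒¬CoversNoFree D regular ab)

  avoidsSomeFree : ∀ a b → Arc D a b → ∃[ s ] (Free D s × ¬ Covers D a b s)
  avoidsSomeFree a b ab = free-search D (¬? ∘ Covers? a b) λ none →
    arc⇒¬CoversAllFree D regular ab (λ s free → decidable-stable (Covers? a b s) (none s free))
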